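{- Let $m,n\geq 1$ and let $\mathcal{K}=\langle K_1,\dots,K_n\rangle$ be a collection of simplicial complexes $K_i\subseteq 2^{[m]}$. Then $\mathcal{K}$ is collective $n$-unavoidable if and only if for each simplex $a=(A_1,\dots,A_n)$ of $[n]^{\ast m}$ the bipartite graph $\Gamma^{\notin}_a=\{(i,j)\in[n]\times[n]\mid A_i\notin K_j\}$ does not admit a perfect matching.
   Context: Simplices of $[n]^{\ast m}$ are $n$-tuples $(A_1,\dots,A_n)$ of pairwise disjoint subsets of $[m]$. The collection $\mathcal{K}$ is called collective $n$-unavoidable if for each ordered partition $B_1\uplus\cdots\uplus B_n=[m]$ of $[m]$ (into $n$ possibly empty parts) there exists $i\in[n]$ with $B_i\in K_i$. The graph $\Gamma^{\notin}_a$ is bipartite with both vertex classes a copy of $[n]$. -}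

module Defs where

open import Data.Nat using (ℕ)
open import Data.Fin using (Fin)
open import Data.Fin.Subset using (Subset; _⊆_; _∈_; _∉_)
open import Data.Fin.Permutation using (Permutation′; _⟨$⟩ʳ_)
open import Data.Product using (Σ; ∃; _×_)
open import Relation.Nullary using (¬_)
open import Relation.Binary.PropositionalEquality using (_≢_)

Family : ℕ → Set₁
Family m = Subset m → Set

IsSimplicialComplex : ∀ {m} → Family m → Set
IsSimplicialComplex {m} K = ∀ (X Y : Subset m) → Y ⊆ X → K X → K Y

Disjoint : ∀ {m} → Subset m → Subset m → Set
Disjoint {m} X Y = ∀ (x : Fin m) → x ∈ X → x ∉ Y

-- Simplex of [n]^{*m}: n-tuple of pairwise disjoint subsets of [m].
IsSimplex : ∀ {m n} → (Fin n → Subset m) → Set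
IsSimplex {m} {n} A = ∀ (i j : Fin n) → i ≢ j → Disjoint (A i) (A j)

IsOrderedPartition : ∀ {m n} → (Fin n → Subset m) → Set
IsOrderedPartition {m} {n} B =
  IsSimplex B × (∀ (x : Fin m) → ∃ λ (i : Fin n) → x ∈ B i)

CollectiveUnavoidable : ∀ {m n} → (Fin n → Family m) → Set
CollectiveUnavoidable {m} {n} K =
  ∀ (B : Fin n → Subset m) → IsOrderedPartition B → ∃ λ (i : Fin n) → K i (B i)

Γ∉ : ∀ {m n} → (Fin n → Family m) → (Fin n → Subset m) → Fin n → Fin n → Set
Γ∉ K A i j = ¬ K j (A i)

HasPerfectMatching : ∀ {n} → (Fin n → Fin n → Set) → Set
HasPerfectMatching {n} E = Σ (Permutation′ n) λ σ → ∀ (i : Fin n) → E i (σ ⟨$⟩ʳ i)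

module Submission where

open import Defs
open import Data.Nat using (ℕ; _≥_; zero; suc; s≤s)
open import Data.Fin using (Fin; zero; suc)
open import Data.Fin.Properties using (any?; 0≢1+n)
open import Data.Fin.Subset using (Subset; _∈_; _⊆_; ∁; ⋃)
open import Data.Fin.Subset.Properties
  using (_∈?_; ∉⊥; x∈p∪q⁻; p⊆p∪q; q⊆p∪q; x∈∁p⇒x∉p; x∉p⇒x∈∁p)
open import Data.Fin.Permutation using (_⟨$⟩ʳ_; _⟨$⟩ˡ_; inverseʳ; flip)
import Data.Fin.Permutation as Permutation
open import Data.List using (tabulate)
open import Data.Empty using (⊥-elim)
open import Data.Product using (∃; _,_)
open import Data.Sum using (inj₁; inj₂)
open import Function using (_∘_)
open import Function.Bundles using (_⇔_; mk⇔; Injection)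
open import Function.Definitions using (Injective)
open import Function.Properties.Inverse using (↔⇒↣)
open import Relation.Nullary using (¬_; Dec; yes; no)
open import Relation.Binary.PropositionalEquality using (_≡_; refl; subst)

-- Given a simplex A with a perfect matching σ of Γ∉, reindex A along σ⁻¹ and put every
-- uncovered element of [m] into the first part: this gives an ordered partition B with
-- A (σ⁻¹ j) ⊆ B j, so unavoidability and downward closure yield some A (σ⁻¹ j) ∈ K j,
-- contradicting the matching edge at σ⁻¹ j. Conversely, if an ordered partition B avoids
-- every K i, the identity is a perfect matching of Γ∉ for the simplex B.

∈-⋃-tabulate⁺ : ∀ {m n} (A : Fin n → Subset m) (i : Fin n) {x : Fin m} →
                x ∈ A i → x ∈ ⋃ (tabulate A)
∈-⋃-tabulate⁺ A zero    x∈A = p⊆p∪q _ x∈A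
∈-⋃-tabulate⁺ A (suc i) x∈A = q⊆p∪q (A zero) _ (∈-⋃-tabulate⁺ (A ∘ suc) i x∈A)

∈-⋃-tabulate⁻ : ∀ {m n} (A : Fin n → Subset m) {x : Fin m} →
                x ∈ ⋃ (tabulate A) → ∃ λ i → x ∈ A i
∈-⋃-tabulate⁻ {n = zero}  A x∈⊥ = ⊥-elim (∉⊥ x∈⊥)
∈-⋃-tabulate⁻ {n = suc n} A x∈⋃ with x∈p∪q⁻ (A zero) _ x∈⋃
... | inj₁ x∈A₀ = zero , x∈A₀
... | inj₂ x∈⋃ᵣ with ∈-⋃-tabulate⁻ (A ∘ suc) x∈⋃ᵣ
...   | i , x∈Aᵢ = suc i , x∈Aᵢ

IsSimplex-∘ : ∀ {m n k} {A : Fin n → Subset m} {f : Fin k → Fin n} →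
              Injective _≡_ _≡_ f → IsSimplex A → IsSimplex (A ∘ f)
IsSimplex-∘ f-inj simplex i j i≢j = simplex _ _ (i≢j ∘ f-inj)

fillFirst : ∀ {m n} → (Fin (suc n) → Subset m) → Fin (suc n) → Subset m
fillFirst A zero    = ∁ (⋃ (tabulate (A ∘ suc)))
fillFirst A (suc i) = A (suc i)

module _ {m n : ℕ} {A : Fin (suc n) → Subset m} (simplex : IsSimplex A) where

  fillFirst-⊇ : ∀ i → A i ⊆ fillFirst A i
  fillFirst-⊇ zero    x∈A₀ = x∉p⇒x∈∁p λ x∈⋃ →
    let i , x∈Aᵢ = ∈-⋃-tabulate⁻ (A ∘ suc) x∈⋃ in simplex zero (suc i) 0≢1+n _ x∈A₀ x∈Aᵢ
  fillFirst-⊇ (suc i) x∈A  = x∈A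

  fillFirst-isSimplex : IsSimplex (fillFirst A)
  fillFirst-isSimplex zero    zero    0≢0 = ⊥-elim (0≢0 refl)
  fillFirst-isSimplex zero    (suc j) _   x x∈F x∈Aⱼ =
    x∈∁p⇒x∉p x∈F (∈-⋃-tabulate⁺ (A ∘ suc) j x∈Aⱼ)
  fillFirst-isSimplex (suc i) zero    _   x x∈Aᵢ x∈F =
    x∈∁p⇒x∉p x∈F (∈-⋃-tabulate⁺ (A ∘ suc) i x∈Aᵢ)
  fillFirst-isSimplex (suc i) (suc j) i≢j = simplex (suc i) (suc j) i≢j

  fillFirst-covers : ∀ x → ∃ λ i → x ∈ fillFirst A i
  fillFirst-covers x with x ∈? ⋃ (tabulate (A ∘ suc))
  ... | yes x∈⋃ with ∈-⋃-tabulate⁻ (A ∘ suc) x∈⋃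
  ...   | i , x∈Aᵢ = suc i , x∈Aᵢ
  fillFirst-covers x | no x∉⋃ = zero , x∉p⇒x∈∁p x∉⋃

  fillFirst-isOrderedPartition : IsOrderedPartition (fillFirst A)
  fillFirst-isOrderedPartition = fillFirst-isSimplex , fillFirst-covers

unavoidable-simplex : ∀ {m n} (K : Fin (suc n) → Family m) →
  (∀ i → IsSimplicialComplex (K i)) → CollectiveUnavoidable K →
  ∀ A → IsSimplex A → ∃ λ i → K i (A i)
unavoidable-simplex K complex unavoidable A simplex
  with unavoidable (fillFirst A) (fillFirst-isOrderedPartition simplex)
... | i , K∋Bᵢ = i , complex i _ (A i) (fillFirst-⊇ simplex i) K∋Bᵢ

unavoidable⇒¬perfectMatching : ∀ {m n} (K : Fin (suc n) → Family m) →
  (∀ i → IsSimplicialComplex (K i)) → CollectiveUnavoidable K →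
  ∀ A → IsSimplex A → ¬ HasPerfectMatching (Γ∉ K A)
unavoidable⇒¬perfectMatching K complex unavoidable A simplex (σ , matched)
  with unavoidable-simplex K complex unavoidable (A ∘ (σ ⟨$⟩ˡ_))
         (IsSimplex-∘ (Injection.injective (↔⇒↣ (flip σ))) simplex)
... | j , K∋A = subst (λ k → ¬ K k (A (σ ⟨$⟩ˡ j))) (inverseʳ σ) (matched (σ ⟨$⟩ˡ j)) K∋A

¬perfectMatching⇒unavoidable : ∀ {m n} (K : Fin n → Family m) →
  (∀ i X → Dec (K i X)) →
  (∀ A → IsSimplex A → ¬ HasPerfectMatching (Γ∉ K A)) → CollectiveUnavoidable K
¬perfectMatching⇒unavoidable K K? noMatching B (simplex , _) with any? (λ i → K? i (B i))
... | yes K∋Bᵢ = K∋Bᵢ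
... | no  K∌B  = ⊥-elim (noMatching B simplex (Permutation.id , λ i K∋Bᵢ → K∌B (i , K∋Bᵢ)))

proposition2p6 : (m n : ℕ) → m ≥ 1 → n ≥ 1 →
    (K : Fin n → Family m) →
    (∀ (i : Fin n) → IsSimplicialComplex (K i)) →
    (∀ (i : Fin n) (X : Subset m) → Dec (K i X)) →
    CollectiveUnavoidable K ⇔
      (∀ (A : Fin n → Subset m) → IsSimplex A → ¬ HasPerfectMatching (Γ∉ K A))
proposition2p6 m (suc n) _ (s≤s _) K complex K? =
  mk⇔ (unavoidable⇒¬perfectMatching K complex) (¬perfectMatching⇒unavoidable K K?)
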